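{- For all $\phi\in \mathrm{PL}(\mathrm{NE})$ and all $\mathsf{X}\supseteq \mathsf{P}(\phi)$, either $|\phi|_\mathsf{X}=|\phi^f|_\mathsf{X}$, or $\phi\equiv \bot\wedge\mathrm{NE}$.
   Context: $\mathrm{PL}(\mathrm{NE})$: $\phi ::= p \mid \bot \mid \neg\phi \mid \phi\wedge\phi \mid \phi\vee\phi \mid \mathrm{NE}$, on propositional teams with support $\models$ / anti-support $\models^-$: $p$ supported iff all $w\in s$ make $p$ true, anti-supported iff none do; $s\models\bot$ iff $s=\emptyset$, $\bot$ always anti-supported; $s\models\mathrm{NE}$ iff $s\ne\emptyset$, $s\models^-\mathrm{NE}$ iff $s=\emptyset$; $\neg$ swaps support and anti-support; $\wedge$ supported iff both conjuncts are, anti-supported iff $s=t\cup u$ with $t\models^-\phi,u\models^-\psi$; $\vee$ supported iff $s=t\cup u$ with $t\models\phi,u\models\psi$, anti-supported iff both are. The flattening $\phi^f$ (a classical formula) is defined by $p^f=p$, $\bot^f=\bot$, $\mathrm{NE}^f=\top$ (where $\top:=\neg\bot$), $(\neg\phi)^f=\neg\phi^f$, $(\phi\wedge\psi)^f=\phi^f\wedge\psi^f$, $(\phi\vee\psi)^f=\phi^f\vee\psi^f$. The ground team $|\phi|_\mathsf{X}$ is the set of valuations $w$ over $\mathsf{X}$ with $w\in s$ for some team $s$ over $\mathsf{X}$ with $s\models\phi$. $\bot\wedge\mathrm{NE}$ is supported by no team. -}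

module Defs where

open import Level using (Level; 0ℓ) renaming (suc to lsuc)
open import Data.Nat using (ℕ)
open import Data.Bool using (Bool; true; false; T)
open import Data.Product using (Σ; _×_; _,_)
open import Data.Sum using (_⊎_)
open import Data.Empty using (⊥)
open import Relation.Nullary using (¬_)
open import Relation.Binary.PropositionalEquality using (_≡_)

Var : Set
Var = ℕ

data Form : Set where
  atom : Var → Form
  bot  : Form
  ne   : Form
  neg  : Form → Form
  _∧ᶠ_ : Form → Form → Form
  _∨ᶠ_ : Form → Form → Form

top : Form
top = neg bot

VarSet : Set
VarSet = Var → Bool

VarsIn : VarSet → Form → Set
VarsIn X (atom p) = T (X p)
VarsIn X bot      = Data.Unit.⊤ where import Data.Unit
VarsIn X ne       = Data.Unit.⊤ where import Data.Unit
VarsIn X (neg φ)  = VarsIn X φ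
VarsIn X (φ ∧ᶠ ψ) = VarsIn X φ × VarsIn X ψ
VarsIn X (φ ∨ᶠ ψ) = VarsIn X φ × VarsIn X ψ

Val : VarSet → Set
Val X = (p : Var) → T (X p) → Bool

Team : VarSet → Set₁
Team X = Val X → Set

module _ {X : VarSet} where

  Empty : Team X → Set
  Empty s = ∀ w → ¬ s w

  NonEmpty : Team X → Set
  NonEmpty s = Σ (Val X) λ w → s w

  IsUnion : Team X → Team X → Team X → Set
  IsUnion s t u = ∀ w → (s w → t w ⊎ u w) × (t w ⊎ u w → s w)

  _⊨_  : Team X → Form → Set₁
  _⊨⁻_ : Team X → Form → Set₁

  s ⊨ atom p   = Level.Lift (lsuc 0ℓ) (∀ w → s w → (h : T (X p)) → w p h ≡ true)
  s ⊨ bot      = Level.Lift (lsuc 0ℓ) (Empty s)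
  s ⊨ ne       = Level.Lift (lsuc 0ℓ) (NonEmpty s)
  s ⊨ neg φ    = s ⊨⁻ φ
  s ⊨ (φ ∧ᶠ ψ) = (s ⊨ φ) × (s ⊨ ψ)
  s ⊨ (φ ∨ᶠ ψ) = Σ (Team X) λ t → Σ (Team X) λ u →
                   Level.Lift (lsuc 0ℓ) (IsUnion s t u) × (t ⊨ φ) × (u ⊨ ψ)

  s ⊨⁻ atom p   = Level.Lift (lsuc 0ℓ) (∀ w → s w → (h : T (X p)) → w p h ≡ false)
  s ⊨⁻ bot      = Level.Lift (lsuc 0ℓ) Data.Unit.⊤ where import Data.Unit
  s ⊨⁻ ne       = Level.Lift (lsuc 0ℓ) (Empty s)
  s ⊨⁻ neg φ    = s ⊨ φ
  s ⊨⁻ (φ ∧ᶠ ψ) = Σ (Team X) λ t → Σ (Team X) λ u →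
                   Level.Lift (lsuc 0ℓ) (IsUnion s t u) × (t ⊨⁻ φ) × (u ⊨⁻ ψ)
  s ⊨⁻ (φ ∨ᶠ ψ) = (s ⊨⁻ φ) × (s ⊨⁻ ψ)

flat : Form → Form
flat (atom p) = atom p
flat bot      = bot
flat ne       = top
flat (neg φ)  = neg (flat φ)
flat (φ ∧ᶠ ψ) = flat φ ∧ᶠ flat ψ
flat (φ ∨ᶠ ψ) = flat φ ∨ᶠ flat ψ

Ground : (X : VarSet) → Form → Val X → Set₁
Ground X φ w = Σ (Team X) λ s → (s ⊨ φ) × Level.Lift (lsuc 0ℓ) (s w)

SameGround : (X : VarSet) → Form → Form → Set₁
SameGround X φ ψ = ∀ w → (Ground X φ w → Ground X ψ w) × (Ground X ψ w → Ground X φ w)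

_≣_ : Form → Form → Set₁
φ ≣ ψ = ∀ (X : VarSet) → VarsIn X φ → VarsIn X ψ → ∀ (s : Team X) →
          (s ⊨ φ → s ⊨ ψ) × (s ⊨ ψ → s ⊨ φ)

{-# OPTIONS --safe #-}
module Submission where

-- A team s supports φ iff s ⊆ ‖φ^f‖ and s contains a model of each of finitely many
-- classical formulas B ∈ req⁺ φ: NE demands a model of ⊤, and a disjunction relativises
-- its disjuncts' demands to the disjuncts, as their witnesses lie in the corresponding half
-- of the split (dually for anti-support and ∧).  Since ⟦_⟧ reads NE as ⊤, the formulas
-- B ∧ φ are classical, and φ is supported by some team iff all of them are satisfiable,
-- which truth tables decide.  If so, ‖φ^f‖_X itself supports φ; as every team supporting
-- φ or φ^f lies inside ‖φ^f‖_X, both ground teams equal ‖φ^f‖_X.  If not, φ, like ⊥ ∧ NE,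
-- is supported by no team.

open import Defs
open import Data.Sum using (_⊎_)

open import Level using (lift)
open import Data.Bool using (Bool; true; false; T; not; _∧_; _∨_; T?)
open import Data.Bool.Properties using (T-≡; T-not-≡; T-∧; T-∨; not-involutive)
open import Data.Empty using (⊥-elim)
open import Data.List using (List; []; _∷_; [_]; _++_; map)
open import Data.List.Membership.Propositional using (_∈_; lose)
open import Data.List.Membership.Propositional.Properties using (∈-++⁺ˡ; ∈-++⁺ʳ; ∈-++⁻; ∈-map⁺)
open import Data.List.Relation.Unary.All as All using (All; []; _∷_; all?)
open import Data.List.Relation.Unary.All.Properties using (++⁺; ++⁻ˡ; ++⁻ʳ; map⁺)
open import Data.List.Relation.Unary.Any using (Any; here; there; any?; satisfied)
open import Data.Nat using (_≟_)
open import Data.Product using (∃; _×_; _,_; proj₁; proj₂)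
open import Data.Sum using (inj₁; inj₂)
import Data.Sum as Sum
open import Data.Unit using (tt)
open import Function using (id; const; _∘_)
open import Function.Bundles using (_⇔_; mk⇔; Equivalence)
open import Relation.Nullary using (¬_; Dec; yes; no)
open import Relation.Nullary.Decidable using (map′)
open import Relation.Binary.PropositionalEquality using (_≡_; refl; sym; cong; cong₂; subst)

open Equivalence using (to; from)

T-not-∧ : ∀ {x y} → T (not (x ∧ y)) ⇔ (T (not x) ⊎ T (not y))
T-not-∧ {true}  = mk⇔ inj₂ Sum.[ (λ ()) , id ]
T-not-∧ {false} = mk⇔ inj₁ (const _)

T-not-∨ : ∀ {x y} → T (not (x ∨ y)) ⇔ (T (not x) × T (not y))
T-not-∨ {true}  = mk⇔ (λ ()) proj₁
T-not-∨ {false} = mk⇔ (_ ,_) proj₂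

⟦_⟧ : Form → (Var → Bool) → Bool
⟦ atom p ⟧ ρ = ρ p
⟦ bot ⟧    ρ = false
⟦ ne ⟧     ρ = true
⟦ neg φ ⟧  ρ = not (⟦ φ ⟧ ρ)
⟦ φ ∧ᶠ ψ ⟧ ρ = ⟦ φ ⟧ ρ ∧ ⟦ ψ ⟧ ρ
⟦ φ ∨ᶠ ψ ⟧ ρ = ⟦ φ ⟧ ρ ∨ ⟦ ψ ⟧ ρ

Satisfiable : Form → Set
Satisfiable φ = ∃ λ ρ → T (⟦ φ ⟧ ρ)

⟦⟧-flat : ∀ φ {ρ} → ⟦ flat φ ⟧ ρ ≡ ⟦ φ ⟧ ρ
⟦⟧-flat (atom p) = refl
⟦⟧-flat bot      = refl
⟦⟧-flat ne       = refl
⟦⟧-flat (neg φ)  = cong not (⟦⟧-flat φ)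
⟦⟧-flat (φ ∧ᶠ ψ) = cong₂ _∧_ (⟦⟧-flat φ) (⟦⟧-flat ψ)
⟦⟧-flat (φ ∨ᶠ ψ) = cong₂ _∨_ (⟦⟧-flat φ) (⟦⟧-flat ψ)

vars : Form → List Var
vars (atom p) = [ p ]
vars bot      = []
vars ne       = []
vars (neg φ)  = vars φ
vars (φ ∧ᶠ ψ) = vars φ ++ vars ψ
vars (φ ∨ᶠ ψ) = vars φ ++ vars ψ

⟦⟧-cong : ∀ φ {ρ ρ′} → (∀ {q} → q ∈ vars φ → ρ q ≡ ρ′ q) → ⟦ φ ⟧ ρ ≡ ⟦ φ ⟧ ρ′
⟦⟧-cong (atom p) agree = agree (here refl)
⟦⟧-cong bot      agree = refl
⟦⟧-cong ne       agree = refl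
⟦⟧-cong (neg φ)  agree = cong not (⟦⟧-cong φ agree)
⟦⟧-cong (φ ∧ᶠ ψ) agree =
  cong₂ _∧_ (⟦⟧-cong φ (agree ∘ ∈-++⁺ˡ)) (⟦⟧-cong ψ (agree ∘ ∈-++⁺ʳ (vars φ)))
⟦⟧-cong (φ ∨ᶠ ψ) agree =
  cong₂ _∨_ (⟦⟧-cong φ (agree ∘ ∈-++⁺ˡ)) (⟦⟧-cong ψ (agree ∘ ∈-++⁺ʳ (vars φ)))

update : Var → Bool → (Var → Bool) → Var → Bool
update p b ρ q with q ≟ p
... | yes _ = b
... | no _  = ρ q

assignments : List Var → List (Var → Bool)
assignments []       = [ const false ]
assignments (p ∷ ps) = map (update p true) (assignments ps) ++ map (update p false) (assignments ps)

assignments-complete : ∀ ps (ρ : Var → Bool) →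
                       ∃ λ ρ′ → ρ′ ∈ assignments ps × (∀ {q} → q ∈ ps → ρ′ q ≡ ρ q)
assignments-complete []       ρ = const false , here refl , λ ()
assignments-complete (p ∷ ps) ρ =
  let ρ′ , ρ′∈ , agree = assignments-complete ps ρ in
  update p (ρ p) ρ′ , update-∈ (ρ p) ρ′∈ , update-agrees agree
  where
  update-∈ : ∀ b {ρ′} → ρ′ ∈ assignments ps → update p b ρ′ ∈ assignments (p ∷ ps)
  update-∈ true  ρ′∈ = ∈-++⁺ˡ (∈-map⁺ (update p true) ρ′∈)
  update-∈ false ρ′∈ = ∈-++⁺ʳ (map (update p true) (assignments ps)) (∈-map⁺ (update p false) ρ′∈)

  update-agrees : ∀ {ρ′} → (∀ {q} → q ∈ ps → ρ′ q ≡ ρ q) →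
                  ∀ {q} → q ∈ p ∷ ps → update p (ρ p) ρ′ q ≡ ρ q
  update-agrees agree {q} q∈ with q ≟ p | q∈
  ... | yes refl | _          = refl
  ... | no q≢p   | here q≡p   = ⊥-elim (q≢p q≡p)
  ... | no _     | there q∈ps = agree q∈ps

satisfiable? : ∀ φ → Dec (Satisfiable φ)
satisfiable? φ = map′ satisfied complete (any? (λ ρ → T? (⟦ φ ⟧ ρ)) (assignments (vars φ)))
  where
  complete : Satisfiable φ → Any (λ ρ → T (⟦ φ ⟧ ρ)) (assignments (vars φ))
  complete (ρ , sat) =
    let ρ′ , ρ′∈ , agree = assignments-complete (vars φ) ρ in
    lose ρ′∈ (subst T (sym (⟦⟧-cong φ agree)) sat)

req⁺ req⁻ : Form → List Form
req⁺ (atom p) = []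
req⁺ bot      = []
req⁺ ne       = [ top ]
req⁺ (neg φ)  = req⁻ φ
req⁺ (φ ∧ᶠ ψ) = req⁺ φ ++ req⁺ ψ
req⁺ (φ ∨ᶠ ψ) = map (_∧ᶠ φ) (req⁺ φ) ++ map (_∧ᶠ ψ) (req⁺ ψ)
req⁻ (atom p) = []
req⁻ bot      = []
req⁻ ne       = []
req⁻ (neg φ)  = req⁺ φ
req⁻ (φ ∧ᶠ ψ) = map (_∧ᶠ neg φ) (req⁻ φ) ++ map (_∧ᶠ neg ψ) (req⁻ ψ)
req⁻ (φ ∨ᶠ ψ) = req⁻ φ ++ req⁻ ψ

req⁺-flat : ∀ φ → req⁺ (flat φ) ≡ []
req⁻-flat : ∀ φ → req⁻ (flat φ) ≡ []
req⁺-flat (atom p) = refl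
req⁺-flat bot      = refl
req⁺-flat ne       = refl
req⁺-flat (neg φ)  = req⁻-flat φ
req⁺-flat (φ ∧ᶠ ψ) rewrite req⁺-flat φ | req⁺-flat ψ = refl
req⁺-flat (φ ∨ᶠ ψ) rewrite req⁺-flat φ | req⁺-flat ψ = refl
req⁻-flat (atom p) = refl
req⁻-flat bot      = refl
req⁻-flat ne       = refl
req⁻-flat (neg φ)  = req⁺-flat φ
req⁻-flat (φ ∧ᶠ ψ) rewrite req⁻-flat φ | req⁻-flat ψ = refl
req⁻-flat (φ ∨ᶠ ψ) rewrite req⁻-flat φ | req⁻-flat ψ = refl

Consistent : Form → Set
Consistent φ = All (λ B → Satisfiable (B ∧ᶠ φ)) (req⁺ φ)

consistent? : ∀ φ → Dec (Consistent φ)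
consistent? φ = all? (λ B → satisfiable? (B ∧ᶠ φ)) (req⁺ φ)

orFalse : (b : Bool) → (T b → Bool) → Bool
orFalse true  f = f tt
orFalse false f = false

orFalse-T : ∀ b f (h : T b) → orFalse b f ≡ f h
orFalse-T true f tt = refl

module _ {X : VarSet} where

  varsIn-flat : ∀ φ → VarsIn X φ → VarsIn X (flat φ)
  varsIn-flat (atom p) h = h
  varsIn-flat bot      h = h
  varsIn-flat ne       h = tt
  varsIn-flat (neg φ)  h = varsIn-flat φ h
  varsIn-flat (φ ∧ᶠ ψ) (hφ , hψ) = varsIn-flat φ hφ , varsIn-flat ψ hψ
  varsIn-flat (φ ∨ᶠ ψ) (hφ , hψ) = varsIn-flat φ hφ , varsIn-flat ψ hψ

  varsIn-∈ : ∀ φ → VarsIn X φ → ∀ {q} → q ∈ vars φ → T (X q)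
  varsIn-∈ (atom p) h (here refl) = h
  varsIn-∈ (neg φ)  h q∈ = varsIn-∈ φ h q∈
  varsIn-∈ (φ ∧ᶠ ψ) (hφ , hψ) q∈ = Sum.[ varsIn-∈ φ hφ , varsIn-∈ ψ hψ ] (∈-++⁻ (vars φ) q∈)
  varsIn-∈ (φ ∨ᶠ ψ) (hφ , hψ) q∈ = Sum.[ varsIn-∈ φ hφ , varsIn-∈ ψ hψ ] (∈-++⁻ (vars φ) q∈)

  req⁺-varsIn : ∀ φ → VarsIn X φ → All (VarsIn X) (req⁺ φ)
  req⁻-varsIn : ∀ φ → VarsIn X φ → All (VarsIn X) (req⁻ φ)
  req⁺-varsIn (atom p) h = []
  req⁺-varsIn bot      h = []
  req⁺-varsIn ne       h = tt ∷ []
  req⁺-varsIn (neg φ)  h = req⁻-varsIn φ h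
  req⁺-varsIn (φ ∧ᶠ ψ) (hφ , hψ) = ++⁺ (req⁺-varsIn φ hφ) (req⁺-varsIn ψ hψ)
  req⁺-varsIn (φ ∨ᶠ ψ) (hφ , hψ) =
    ++⁺ (map⁺ (All.map (_, hφ) (req⁺-varsIn φ hφ))) (map⁺ (All.map (_, hψ) (req⁺-varsIn ψ hψ)))
  req⁻-varsIn (atom p) h = []
  req⁻-varsIn bot      h = []
  req⁻-varsIn ne       h = []
  req⁻-varsIn (neg φ)  h = req⁺-varsIn φ h
  req⁻-varsIn (φ ∧ᶠ ψ) (hφ , hψ) =
    ++⁺ (map⁺ (All.map (_, hφ) (req⁻-varsIn φ hφ))) (map⁺ (All.map (_, hψ) (req⁻-varsIn ψ hψ)))
  req⁻-varsIn (φ ∨ᶠ ψ) (hφ , hψ) = ++⁺ (req⁻-varsIn φ hφ) (req⁻-varsIn ψ hψ)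

  -- Off X a valuation is read as false; formulas over X never look there (⟦⟧-restrict).
  extend : Val X → Var → Bool
  extend w p = orFalse (X p) (w p)

  restrict : (Var → Bool) → Val X
  restrict ρ p _ = ρ p

  ⟦⟧-restrict : ∀ φ → VarsIn X φ → ∀ {ρ} → ⟦ φ ⟧ (extend (restrict ρ)) ≡ ⟦ φ ⟧ ρ
  ⟦⟧-restrict φ h {ρ} = ⟦⟧-cong φ λ {q} q∈ → orFalse-T (X q) (λ _ → ρ q) (varsIn-∈ φ h q∈)

  Sat : Val X → Form → Set
  Sat w φ = T (⟦ φ ⟧ (extend w))

  ‖_‖ : Form → Team X
  ‖ φ ‖ w = Sat w φ

  _⊆‖_‖ : Team X → Form → Set
  s ⊆‖ φ ‖ = ∀ {w} → s w → Sat w φ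

  _∩‖_‖ : Team X → Form → Team X
  (s ∩‖ φ ‖) w = s w × Sat w φ

  Meets : Team X → Form → Set
  Meets s B = ∃ λ w → s w × Sat w B

  _⊨ₙ_ _⊨ₙ⁻_ : Team X → Form → Set
  s ⊨ₙ  φ = s ⊆‖ φ ‖     × All (Meets s) (req⁺ φ)
  s ⊨ₙ⁻ φ = s ⊆‖ neg φ ‖ × All (Meets s) (req⁻ φ)

  Sat-atom : ∀ w {p} (h : T (X p)) → Sat w (atom p) ⇔ (w p h ≡ true)
  Sat-atom w {p} h rewrite orFalse-T (X p) (w p) h = T-≡

  Sat-neg-atom : ∀ w {p} (h : T (X p)) → Sat w (neg (atom p)) ⇔ (w p h ≡ false)
  Sat-neg-atom w {p} h rewrite orFalse-T (X p) (w p) h = T-not-≡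

  Sat-neg-neg : ∀ {w} φ → Sat w (neg (neg φ)) ⇔ Sat w φ
  Sat-neg-neg φ = mk⇔ (subst T (not-involutive _)) (subst T (sym (not-involutive _)))

  Sat-flat : ∀ {w} φ → Sat w (flat φ) ⇔ Sat w φ
  Sat-flat φ = mk⇔ (subst T (⟦⟧-flat φ)) (subst T (sym (⟦⟧-flat φ)))

  meets-∧ : ∀ {s t} φ {L} → t ⊆‖ φ ‖ → (∀ {w} → t w → s w) →
            All (Meets t) L → All (Meets s) (map (_∧ᶠ φ) L)
  meets-∧ φ t⊆φ t⊆s []                     = []
  meets-∧ φ t⊆φ t⊆s ((w , tw , satB) ∷ ms) =
    (w , t⊆s tw , from T-∧ (satB , t⊆φ tw)) ∷ meets-∧ φ t⊆φ t⊆s ms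

  meets-∩ : ∀ {s} φ L → All (Meets s) (map (_∧ᶠ φ) L) → All (Meets (s ∩‖ φ ‖)) L
  meets-∩ φ []      []                    = []
  meets-∩ φ (B ∷ L) ((w , sw , sat) ∷ ms) =
    let satB , satφ = to T-∧ sat in (w , (sw , satφ) , satB) ∷ meets-∩ φ L ms

  union-⊆ : ∀ {s t u} φ ψ → IsUnion s t u → t ⊆‖ φ ‖ → u ⊆‖ ψ ‖ →
            ∀ {w} → s w → Sat w φ ⊎ Sat w ψ
  union-⊆ φ ψ U t⊆φ u⊆ψ {w} sw = Sum.map t⊆φ u⊆ψ (proj₁ (U w) sw)

  ∩-union : ∀ {s} φ ψ → (∀ {w} → s w → Sat w φ ⊎ Sat w ψ) → IsUnion s (s ∩‖ φ ‖) (s ∩‖ ψ ‖)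
  ∩-union φ ψ split w = (λ sw → Sum.map (sw ,_) (sw ,_) (split sw)) , Sum.[ proj₁ , proj₁ ]

  ⊨⇒⊨ₙ   : ∀ φ {s} → VarsIn X φ → s ⊨ φ → s ⊨ₙ φ
  ⊨ₙ⇒⊨   : ∀ φ {s} → VarsIn X φ → s ⊨ₙ φ → s ⊨ φ
  ⊨⁻⇒⊨ₙ⁻ : ∀ φ {s} → VarsIn X φ → s ⊨⁻ φ → s ⊨ₙ⁻ φ
  ⊨ₙ⁻⇒⊨⁻ : ∀ φ {s} → VarsIn X φ → s ⊨ₙ⁻ φ → s ⊨⁻ φ

  ⊨⇒⊨ₙ (atom p) h (lift f) = (λ {w} sw → from (Sat-atom w h) (f w sw h)) , []
  ⊨⇒⊨ₙ bot      _ (lift e) = (λ {w} sw → ⊥-elim (e w sw)) , []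
  ⊨⇒⊨ₙ ne       _ (lift (w , sw)) = (λ _ → tt) , (w , sw , tt) ∷ []
  ⊨⇒⊨ₙ (neg φ)  h s⊨ = ⊨⁻⇒⊨ₙ⁻ φ h s⊨
  ⊨⇒⊨ₙ (φ ∧ᶠ ψ) (hφ , hψ) (s⊨φ , s⊨ψ) =
    let s⊆φ , reqφ = ⊨⇒⊨ₙ φ hφ s⊨φ
        s⊆ψ , reqψ = ⊨⇒⊨ₙ ψ hψ s⊨ψ
    in (λ sw → from T-∧ (s⊆φ sw , s⊆ψ sw)) , ++⁺ reqφ reqψ
  ⊨⇒⊨ₙ (φ ∨ᶠ ψ) (hφ , hψ) (t , u , lift U , t⊨φ , u⊨ψ) =
    let t⊆φ , reqφ = ⊨⇒⊨ₙ φ hφ t⊨φ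
        u⊆ψ , reqψ = ⊨⇒⊨ₙ ψ hψ u⊨ψ
    in (λ sw → from T-∨ (union-⊆ φ ψ U t⊆φ u⊆ψ sw)) ,
       ++⁺ (meets-∧ φ t⊆φ (λ {w} tw → proj₂ (U w) (inj₁ tw)) reqφ)
           (meets-∧ ψ u⊆ψ (λ {w} uw → proj₂ (U w) (inj₂ uw)) reqψ)

  ⊨ₙ⇒⊨ (atom p) h (s⊆p , _) = lift λ w sw h′ → to (Sat-atom w h′) (s⊆p sw)
  ⊨ₙ⇒⊨ bot      _ (s⊆⊥ , _) = lift λ w sw → s⊆⊥ sw
  ⊨ₙ⇒⊨ ne       _ (_ , (w , sw , _) ∷ []) = lift (w , sw)
  ⊨ₙ⇒⊨ (neg φ)  h s⊨ₙ = ⊨ₙ⁻⇒⊨⁻ φ h s⊨ₙ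
  ⊨ₙ⇒⊨ (φ ∧ᶠ ψ) (hφ , hψ) (s⊆φ∧ψ , req) =
    ⊨ₙ⇒⊨ φ hφ (proj₁ ∘ to T-∧ ∘ s⊆φ∧ψ , ++⁻ˡ (req⁺ φ) req) ,
    ⊨ₙ⇒⊨ ψ hψ (proj₂ ∘ to T-∧ ∘ s⊆φ∧ψ , ++⁻ʳ (req⁺ φ) req)
  ⊨ₙ⇒⊨ (φ ∨ᶠ ψ) {s} (hφ , hψ) (s⊆φ∨ψ , req) =
    s ∩‖ φ ‖ , s ∩‖ ψ ‖ , lift (∩-union φ ψ (to T-∨ ∘ s⊆φ∨ψ)) ,
    ⊨ₙ⇒⊨ φ hφ (proj₂ , meets-∩ φ (req⁺ φ) (++⁻ˡ (map (_∧ᶠ φ) (req⁺ φ)) req)) ,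
    ⊨ₙ⇒⊨ ψ hψ (proj₂ , meets-∩ ψ (req⁺ ψ) (++⁻ʳ (map (_∧ᶠ φ) (req⁺ φ)) req))

  ⊨⁻⇒⊨ₙ⁻ (atom p) h (lift f) = (λ {w} sw → from (Sat-neg-atom w h) (f w sw h)) , []
  ⊨⁻⇒⊨ₙ⁻ bot      _ _        = (λ _ → tt) , []
  ⊨⁻⇒⊨ₙ⁻ ne       _ (lift e) = (λ {w} sw → e w sw) , []
  ⊨⁻⇒⊨ₙ⁻ (neg φ)  h s⊨ =
    let s⊆φ , req = ⊨⇒⊨ₙ φ h s⊨ in (λ sw → from (Sat-neg-neg φ) (s⊆φ sw)) , req
  ⊨⁻⇒⊨ₙ⁻ (φ ∧ᶠ ψ) (hφ , hψ) (t , u , lift U , t⊨φ , u⊨ψ) =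
    let t⊆¬φ , reqφ = ⊨⁻⇒⊨ₙ⁻ φ hφ t⊨φ
        u⊆¬ψ , reqψ = ⊨⁻⇒⊨ₙ⁻ ψ hψ u⊨ψ
    in (λ sw → from T-not-∧ (union-⊆ (neg φ) (neg ψ) U t⊆¬φ u⊆¬ψ sw)) ,
       ++⁺ (meets-∧ (neg φ) t⊆¬φ (λ {w} tw → proj₂ (U w) (inj₁ tw)) reqφ)
           (meets-∧ (neg ψ) u⊆¬ψ (λ {w} uw → proj₂ (U w) (inj₂ uw)) reqψ)
  ⊨⁻⇒⊨ₙ⁻ (φ ∨ᶠ ψ) (hφ , hψ) (s⊨φ , s⊨ψ) =
    let s⊆¬φ , reqφ = ⊨⁻⇒⊨ₙ⁻ φ hφ s⊨φ
        s⊆¬ψ , reqψ = ⊨⁻⇒⊨ₙ⁻ ψ hψ s⊨ψ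
    in (λ sw → from T-not-∨ (s⊆¬φ sw , s⊆¬ψ sw)) , ++⁺ reqφ reqψ

  ⊨ₙ⁻⇒⊨⁻ (atom p) h (s⊆¬p , _) = lift λ w sw h′ → to (Sat-neg-atom w h′) (s⊆¬p sw)
  ⊨ₙ⁻⇒⊨⁻ bot      _ _           = lift tt
  ⊨ₙ⁻⇒⊨⁻ ne       _ (s⊆¬ne , _) = lift λ w sw → s⊆¬ne sw
  ⊨ₙ⁻⇒⊨⁻ (neg φ)  h (s⊆¬¬φ , req) = ⊨ₙ⇒⊨ φ h ((λ sw → to (Sat-neg-neg φ) (s⊆¬¬φ sw)) , req)
  ⊨ₙ⁻⇒⊨⁻ (φ ∧ᶠ ψ) {s} (hφ , hψ) (s⊆¬φ∧ψ , req) =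
    s ∩‖ neg φ ‖ , s ∩‖ neg ψ ‖ , lift (∩-union (neg φ) (neg ψ) (to T-not-∧ ∘ s⊆¬φ∧ψ)) ,
    ⊨ₙ⁻⇒⊨⁻ φ hφ (proj₂ , meets-∩ (neg φ) (req⁻ φ) (++⁻ˡ (map (_∧ᶠ neg φ) (req⁻ φ)) req)) ,
    ⊨ₙ⁻⇒⊨⁻ ψ hψ (proj₂ , meets-∩ (neg ψ) (req⁻ ψ) (++⁻ʳ (map (_∧ᶠ neg φ) (req⁻ φ)) req))
  ⊨ₙ⁻⇒⊨⁻ (φ ∨ᶠ ψ) (hφ , hψ) (s⊆¬φ∨ψ , req) =
    ⊨ₙ⁻⇒⊨⁻ φ hφ (proj₁ ∘ to T-not-∨ ∘ s⊆¬φ∨ψ , ++⁻ˡ (req⁻ φ) req) ,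
    ⊨ₙ⁻⇒⊨⁻ ψ hψ (proj₂ ∘ to T-not-∨ ∘ s⊆¬φ∨ψ , ++⁻ʳ (req⁻ φ) req)

  ‖‖-⊨ : ∀ φ → VarsIn X φ → Consistent φ → ‖ φ ‖ ⊨ φ
  ‖‖-⊨ φ h consistent =
    ⊨ₙ⇒⊨ φ h (id , All.zipWith (λ {B} (hB , sat) → witness B hB sat) (req⁺-varsIn φ h , consistent))
    where
    witness : ∀ B → VarsIn X B → Satisfiable (B ∧ᶠ φ) → Meets ‖ φ ‖ B
    witness B hB (ρ , sat) =
      let satB , satφ = to T-∧ sat in
      restrict ρ , subst T (sym (⟦⟧-restrict φ h)) satφ , subst T (sym (⟦⟧-restrict B hB)) satB

  ⊨⇒consistent : ∀ φ {s} → VarsIn X φ → s ⊨ φ → Consistent φ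
  ⊨⇒consistent φ h s⊨φ =
    let s⊆φ , req = ⊨⇒⊨ₙ φ h s⊨φ in
    All.map (λ { (w , sw , satB) → extend w , from T-∧ (satB , s⊆φ sw) }) req

  ‖flat‖-⊨ : ∀ φ → VarsIn X φ → ‖ flat φ ‖ ⊨ flat φ
  ‖flat‖-⊨ φ h = ⊨ₙ⇒⊨ (flat φ) (varsIn-flat φ h) (id , subst (All _) (sym (req⁺-flat φ)) [])

  ground⇔Sat : ∀ φ → VarsIn X φ → ‖ φ ‖ ⊨ φ → ∀ w → Ground X φ w ⇔ Sat w φ
  ground⇔Sat φ h ‖φ‖⊨φ w =
    mk⇔ (λ { (s , s⊨φ , lift sw) → proj₁ (⊨⇒⊨ₙ φ h s⊨φ) sw }) (λ sat → ‖ φ ‖ , ‖φ‖⊨φ , lift sat)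

  sameGround-flat : ∀ φ → VarsIn X φ → ‖ φ ‖ ⊨ φ → SameGround X φ (flat φ)
  sameGround-flat φ h ‖φ‖⊨φ w =
    from groundᶠ ∘ from (Sat-flat φ) ∘ to groundφ , from groundφ ∘ to (Sat-flat φ) ∘ to groundᶠ
    where
    groundφ : Ground X φ w ⇔ Sat w φ
    groundφ = ground⇔Sat φ h ‖φ‖⊨φ w
    groundᶠ : Ground X (flat φ) w ⇔ Sat w (flat φ)
    groundᶠ = ground⇔Sat (flat φ) (varsIn-flat φ h) (‖flat‖-⊨ φ h) w

unsupported⇒≣⊥∧NE : ∀ φ → (∀ X → VarsIn X φ → (s : Team X) → ¬ s ⊨ φ) → φ ≣ (bot ∧ᶠ ne)
unsupported⇒≣⊥∧NE φ unsupported X h _ s =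
  ⊥-elim ∘ unsupported X h s , λ { (lift e , lift (w , sw)) → ⊥-elim (e w sw) }

lemma3p17 : (φ : Form) (X : VarSet) → VarsIn X φ →
    SameGround X φ (flat φ) ⊎ (φ ≣ (bot ∧ᶠ ne))
lemma3p17 φ X h with consistent? φ
... | yes consistent  = inj₁ (sameGround-flat φ h (‖‖-⊨ φ h consistent))
... | no inconsistent =
  inj₂ (unsupported⇒≣⊥∧NE φ λ X′ h′ _ s⊨φ → inconsistent (⊨⇒consistent φ h′ s⊨φ))
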